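{- Let $k\ge 0$ and let $S=\{s_1,s_2,\dots,s_n\}$ be the starting configuration, with $s_1\le s_2\le\dots\le s_n$. Then there exists an optimal $k$-step strategy whose first move is $(s_1,s_2)$.
   Context: One-player game: Alice has $n\ge2$ sheets of paper, each with a positive integer written on it. A move consists of choosing two sheets, with numbers $a$ and $b$, erasing them and writing $a+b$ on both sheets; this move is denoted $(a,b)$. The configuration is the multiset of the numbers on the sheets. $opt(S,k)$ is the smallest possible sum of the numbers after exactly $k$ moves starting from configuration $S$. An optimal $k$-step strategy is a sequence of $k$ moves from the starting configuration after which the sum equals $opt(S,k)$. -}

module Defs where

open import Data.Nat using (ℕ; zero; suc; _+_; _≤_; _<_)
open import Data.Fin using (Fin; _≟_)
import Data.Fin as Fin
open import Data.Vec using (Vec; lookup; _[_]≔_; sum)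
open import Data.List using (List; []; _∷_; length)
open import Data.Product using (Σ; _×_; _,_)
open import Relation.Binary.PropositionalEquality using (_≡_)
open import Relation.Nullary using (¬_)

-- A configuration of n sheets: the number written on each sheet.
Config : ℕ → Set
Config n = Vec ℕ n

Positive : ∀ {n} → Config n → Set
Positive {n} s = (i : Fin n) → 0 < lookup s i

Sorted : ∀ {n} → Config n → Set
Sorted {n} s = (i j : Fin n) → Data.Fin._≤_ i j → lookup s i ≤ lookup s j

Move : ℕ → Set
Move n = Σ (Fin n) λ i → Σ (Fin n) λ j → ¬ (i ≡ j)

applyMove : ∀ {n} → Move n → Config n → Config n
applyMove (i , j , _) s =
  let c = lookup s i + lookup s j in
  (s [ i ]≔ c) [ j ]≔ c

run : ∀ {n} → List (Move n) → Config n → Config n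
run [] s = s
run (m ∷ ms) s = run ms (applyMove m s)

-- A k-step strategy is a list of moves of length exactly k.
-- It is optimal if its final sum is ≤ the final sum of every k-step strategy,
-- i.e. its final sum equals opt(S,k).
OptimalStrategy : ∀ {n} → Config n → ℕ → List (Move n) → Set
OptimalStrategy {n} s k ms =
  length ms ≡ k ×
  ((ms' : List (Move n)) → length ms' ≡ k → sum (run ms s) ≤ sum (run ms' s))

firstTwo : (n : ℕ) → Move (suc (suc n))
firstTwo n = Fin.zero , Fin.suc Fin.zero , λ ()

-- Exchange argument, by induction on k.  Call (a, b) a smallest move if sheets a and b carry
-- the two smallest numbers.  Every strategy of k + 1 moves can be replaced, at no greater final
-- sum, by one starting with a smallest move (a, b).  If its first move is disjoint from {a, b},
-- the two first moves commute.  If it is (a, c), then b is still a smallest sheet afterwards, so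
-- by induction the rest may start with (b, r) for r a smallest remaining sheet.  The configuration
-- reached by (a, c), (b, r) is compared with one reached by (a, b) and a single further move, up
-- to relabelling the sheets; this uses that the final sum of a fixed sequence of moves is
-- monotone and linear in the starting configuration and invariant under relabelling.  Optimal
-- strategies exist because always playing a smallest move is optimal.

module Submission where

open import Defs
open import Data.Nat using (ℕ; zero; suc; _+_; _*_; _≤_; _≤?_; z≤n; s≤s)
open import Data.Nat.Properties hiding (_≟_)
open import Data.Nat.Tactic.RingSolver using (solve-∀)
open import Algebra.Properties.CommutativeSemigroup +-commutativeSemigroup using (interchange)
import Algebra.Properties.CommutativeMonoid.Sum +-0-commutativeMonoid as FinSum
open import Data.Fin using (Fin; _≟_)
import Data.Fin as Fin
open import Data.Fin.Permutation using (Permutation′; _⟨$⟩ʳ_; _⟨$⟩ˡ_; inverseˡ; transpose)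
open import Data.Vec using (Vec; []; _∷_; lookup; _[_]≔_; sum; zipWith; map; tabulate; replicate)
open import Data.Vec.Properties
  using (lookup∘update; lookup∘update′; lookup-zipWith; lookup-map; lookup∘tabulate; tabulate∘lookup; tabulate-cong; lookup-replicate)
open import Data.List using (List; []; _∷_; length)
import Data.List as List
open import Data.List.Properties using (length-map)
open import Data.Product using (Σ; ∃; _×_; _,_; proj₁; proj₂)
import Data.Product as Product
open import Data.Sum using (_⊎_; inj₁; inj₂)
import Data.Sum as Sum
open import Data.Unit using (⊤; tt)
open import Data.Empty using (⊥-elim)
open import Function using (_∘_)
open import Relation.Binary.PropositionalEquality
open import Relation.Nullary using (¬_; Dec; yes; no; ¬?)
open import Relation.Nullary.Decidable using (dec-true; dec-false)
open import Relation.Unary using (Decidable)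

private
  variable
    n : ℕ

infix 4 _∈ₘ_ _∉ₘ_ _∈ₘ?_

_∈ₘ_ : Fin n → Move n → Set
l ∈ₘ (i , j , _) = l ≡ i ⊎ l ≡ j

_∉ₘ_ : Fin n → Move n → Set
l ∉ₘ (i , j , _) = l ≢ i × l ≢ j

_∈ₘ?_ : (l : Fin n) (m : Move n) → l ∈ₘ m ⊎ l ∉ₘ m
l ∈ₘ? (i , j , _) with l ≟ i | l ≟ j
... | yes l≡i | _       = inj₁ (inj₁ l≡i)
... | no _    | yes l≡j = inj₁ (inj₂ l≡j)
... | no l≢i  | no l≢j  = inj₂ (l≢i , l≢j)

pairSum : Move n → Config n → ℕ
pairSum (i , j , _) x = lookup x i + lookup x j

flipMove : Move n → Move n
flipMove (i , j , i≢j) = j , i , i≢j ∘ sym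

lookup-extensionality : {x y : Config n} → (∀ l → lookup x l ≡ lookup y l) → x ≡ y
lookup-extensionality {x = x} {y} x≗y =
  trans (sym (tabulate∘lookup x)) (trans (tabulate-cong x≗y) (tabulate∘lookup y))

lookup-applyMove-∈ : ∀ (m : Move n) x {l} → l ∈ₘ m → lookup (applyMove m x) l ≡ pairSum m x
lookup-applyMove-∈ (i , j , i≢j) x (inj₁ refl) =
  trans (lookup∘update′ i≢j (x [ i ]≔ pairSum (i , j , i≢j) x) _) (lookup∘update i x _)
lookup-applyMove-∈ (i , j , i≢j) x (inj₂ refl) = lookup∘update j (x [ i ]≔ pairSum (i , j , i≢j) x) _

lookup-applyMove-∉ : ∀ (m : Move n) x {l} → l ∉ₘ m → lookup (applyMove m x) l ≡ lookup x l
lookup-applyMove-∉ m@(i , j , _) x (l≢i , l≢j) =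
  trans (lookup∘update′ l≢j (x [ i ]≔ pairSum m x) _) (lookup∘update′ l≢i x _)

sum-[]≔ : ∀ (x : Config n) i v → sum (x [ i ]≔ v) + lookup x i ≡ sum x + v
sum-[]≔ (x ∷ xs) Fin.zero v = trans (+-assoc v (sum xs) x) (trans (cong (v +_) (+-comm (sum xs) x)) (+-comm v _))
sum-[]≔ (x ∷ xs) (Fin.suc i) v = trans (+-assoc x _ _) (trans (cong (x +_) (sum-[]≔ xs i v)) (sym (+-assoc x _ _)))

sum-applyMove : ∀ (m : Move n) x → sum (applyMove m x) ≡ sum x + pairSum m x
sum-applyMove (i , j , i≢j) x = +-cancelʳ-≡ _ _ _ (begin
  sum (u [ j ]≔ c) + c                        ≡⟨ cong (sum (u [ j ]≔ c) +_) (+-comm (lookup x i) _) ⟩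
  sum (u [ j ]≔ c) + (lookup x j + lookup x i) ≡⟨ +-assoc (sum (u [ j ]≔ c)) _ _ ⟨
  sum (u [ j ]≔ c) + lookup x j + lookup x i  ≡⟨ cong (λ v → sum (u [ j ]≔ c) + v + lookup x i) u-j ⟨
  sum (u [ j ]≔ c) + lookup u j + lookup x i  ≡⟨ cong (_+ lookup x i) (sum-[]≔ u j c) ⟩
  sum u + c + lookup x i                      ≡⟨ +-assoc (sum u) c _ ⟩
  sum u + (c + lookup x i)                    ≡⟨ cong (sum u +_) (+-comm c _) ⟩
  sum u + (lookup x i + c)                    ≡⟨ +-assoc (sum u) _ c ⟨
  sum u + lookup x i + c                      ≡⟨ cong (_+ c) (sum-[]≔ x i c) ⟩
  sum x + c + c                               ∎)
  where
  open ≡-Reasoning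
  c = lookup x i + lookup x j
  u = x [ i ]≔ c
  u-j : lookup u j ≡ lookup x j
  u-j = lookup∘update′ (i≢j ∘ sym) x c

applyMove-flip : ∀ (m : Move n) x → applyMove (flipMove m) x ≡ applyMove m x
applyMove-flip m@(i , j , _) x = lookup-extensionality at
  where
  at : ∀ l → lookup (applyMove (flipMove m) x) l ≡ lookup (applyMove m x) l
  at l with l ∈ₘ? m
  ... | inj₁ l∈m = trans (lookup-applyMove-∈ (flipMove m) x (Sum.swap l∈m))
                     (trans (+-comm (lookup x j) _) (sym (lookup-applyMove-∈ m x l∈m)))
  ... | inj₂ l∉m = trans (lookup-applyMove-∉ (flipMove m) x (Product.swap l∉m))
                     (sym (lookup-applyMove-∉ m x l∉m))

Disjoint : Move n → Move n → Set
Disjoint m (i , j , _) = i ∉ₘ m × j ∉ₘ m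

disjoint-sym : ∀ (m m' : Move n) → Disjoint m m' → Disjoint m' m
disjoint-sym (a , b , _) (i , j , _) ((i≢a , i≢b) , (j≢a , j≢b)) =
  (i≢a ∘ sym , j≢a ∘ sym) , (i≢b ∘ sym , j≢b ∘ sym)

∈-disjoint⇒∉ : ∀ (m m' : Move n) {l} → Disjoint m' m → l ∈ₘ m → l ∉ₘ m'
∈-disjoint⇒∉ _ _ (i∉m' , _) (inj₁ refl) = i∉m'
∈-disjoint⇒∉ _ _ (_ , j∉m') (inj₂ refl) = j∉m'

pairSum-applyMove-disjoint : ∀ (m m' : Move n) x → Disjoint m m' → pairSum m' (applyMove m x) ≡ pairSum m' x
pairSum-applyMove-disjoint m m' x (i∉m , j∉m) =
  cong₂ _+_ (lookup-applyMove-∉ m x i∉m) (lookup-applyMove-∉ m x j∉m)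

applyMove-comm : ∀ (m m' : Move n) x → Disjoint m m' →
  applyMove m (applyMove m' x) ≡ applyMove m' (applyMove m x)
applyMove-comm m m' x disj = lookup-extensionality at
  where
  open ≡-Reasoning
  disj′ : Disjoint m' m
  disj′ = disjoint-sym m m' disj
  at : ∀ l → lookup (applyMove m (applyMove m' x)) l ≡ lookup (applyMove m' (applyMove m x)) l
  at l with l ∈ₘ? m | l ∈ₘ? m'
  ... | inj₁ l∈m | _ = begin
    lookup (applyMove m (applyMove m' x)) l  ≡⟨ lookup-applyMove-∈ m (applyMove m' x) l∈m ⟩
    pairSum m (applyMove m' x)               ≡⟨ pairSum-applyMove-disjoint m' m x disj′ ⟩
    pairSum m x                              ≡⟨ lookup-applyMove-∈ m x l∈m ⟨
    lookup (applyMove m x) l                 ≡⟨ lookup-applyMove-∉ m' (applyMove m x) (∈-disjoint⇒∉ m m' disj′ l∈m) ⟨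
    lookup (applyMove m' (applyMove m x)) l  ∎
  ... | inj₂ l∉m | inj₁ l∈m' = begin
    lookup (applyMove m (applyMove m' x)) l  ≡⟨ lookup-applyMove-∉ m (applyMove m' x) l∉m ⟩
    lookup (applyMove m' x) l                ≡⟨ lookup-applyMove-∈ m' x l∈m' ⟩
    pairSum m' x                             ≡⟨ pairSum-applyMove-disjoint m m' x disj ⟨
    pairSum m' (applyMove m x)               ≡⟨ lookup-applyMove-∈ m' (applyMove m x) l∈m' ⟨
    lookup (applyMove m' (applyMove m x)) l  ∎
  ... | inj₂ l∉m | inj₂ l∉m' = begin
    lookup (applyMove m (applyMove m' x)) l  ≡⟨ lookup-applyMove-∉ m (applyMove m' x) l∉m ⟩
    lookup (applyMove m' x) l                ≡⟨ lookup-applyMove-∉ m' x l∉m' ⟩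
    lookup x l                               ≡⟨ lookup-applyMove-∉ m x l∉m ⟨
    lookup (applyMove m x) l                 ≡⟨ lookup-applyMove-∉ m' (applyMove m x) l∉m' ⟨
    lookup (applyMove m' (applyMove m x)) l  ∎

cost : List (Move n) → Config n → ℕ
cost ms x = sum (run ms x)

infix 4 _≤ᶜ_

_≤ᶜ_ : Config n → Config n → Set
x ≤ᶜ y = ∀ l → lookup x l ≤ lookup y l

≤-by : ∀ {p p′ q q′} → p ≡ p′ → q ≡ q′ → p′ ≤ q′ → p ≤ q
≤-by refl refl p′≤q′ = p′≤q′

applyMove-mono : ∀ (m : Move n) {x y} → x ≤ᶜ y → applyMove m x ≤ᶜ applyMove m y
applyMove-mono m@(i , j , _) {x} {y} x≤y l with l ∈ₘ? m
... | inj₁ l∈m = ≤-by (lookup-applyMove-∈ m x l∈m) (lookup-applyMove-∈ m y l∈m) (+-mono-≤ (x≤y i) (x≤y j))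
... | inj₂ l∉m = ≤-by (lookup-applyMove-∉ m x l∉m) (lookup-applyMove-∉ m y l∉m) (x≤y l)

applyMove-increasing : ∀ (m : Move n) x → x ≤ᶜ applyMove m x
applyMove-increasing m@(i , j , _) x l with l ∈ₘ? m
... | inj₁ (inj₁ refl) = ≤-by refl (lookup-applyMove-∈ m x (inj₁ refl)) (m≤m+n (lookup x i) (lookup x j))
... | inj₁ (inj₂ refl) = ≤-by refl (lookup-applyMove-∈ m x (inj₂ refl)) (m≤n+m (lookup x j) (lookup x i))
... | inj₂ l∉m         = ≤-by refl (lookup-applyMove-∉ m x l∉m) ≤-refl

sum-mono : {x y : Config n} → x ≤ᶜ y → sum x ≤ sum y
sum-mono {x = []}     {[]}     _   = z≤n
sum-mono {x = _ ∷ xs} {_ ∷ ys} x≤y = +-mono-≤ (x≤y Fin.zero) (sum-mono {x = xs} {ys} (x≤y ∘ Fin.suc))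

cost-mono : ∀ (ms : List (Move n)) {x y} → x ≤ᶜ y → cost ms x ≤ cost ms y
cost-mono []       {x} {y} x≤y = sum-mono {x = x} {y} x≤y
cost-mono (m ∷ ms) {x} {y} x≤y = cost-mono ms {applyMove m x} {applyMove m y} (applyMove-mono m {x} {y} x≤y)

infixl 6 _⊕_
infixr 7 _·_

_⊕_ : Config n → Config n → Config n
_⊕_ = zipWith _+_

_·_ : ℕ → Config n → Config n
d · x = map (d *_) x

applyMove-⊕ : ∀ (m : Move n) x y → applyMove m (x ⊕ y) ≡ applyMove m x ⊕ applyMove m y
applyMove-⊕ m@(i , j , _) x y = lookup-extensionality at
  where
  open ≡-Reasoning
  at : ∀ l → lookup (applyMove m (x ⊕ y)) l ≡ lookup (applyMove m x ⊕ applyMove m y) l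
  at l with l ∈ₘ? m
  ... | inj₁ l∈m = begin
    lookup (applyMove m (x ⊕ y)) l                      ≡⟨ lookup-applyMove-∈ m (x ⊕ y) l∈m ⟩
    lookup (x ⊕ y) i + lookup (x ⊕ y) j                 ≡⟨ cong₂ _+_ (lookup-zipWith _+_ i x y) (lookup-zipWith _+_ j x y) ⟩
    (lookup x i + lookup y i) + (lookup x j + lookup y j) ≡⟨ interchange (lookup x i) (lookup y i) (lookup x j) (lookup y j) ⟩
    pairSum m x + pairSum m y                           ≡⟨ cong₂ _+_ (lookup-applyMove-∈ m x l∈m) (lookup-applyMove-∈ m y l∈m) ⟨
    lookup (applyMove m x) l + lookup (applyMove m y) l ≡⟨ lookup-zipWith _+_ l (applyMove m x) (applyMove m y) ⟨
    lookup (applyMove m x ⊕ applyMove m y) l            ∎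
  ... | inj₂ l∉m = begin
    lookup (applyMove m (x ⊕ y)) l                      ≡⟨ lookup-applyMove-∉ m (x ⊕ y) l∉m ⟩
    lookup (x ⊕ y) l                                    ≡⟨ lookup-zipWith _+_ l x y ⟩
    lookup x l + lookup y l                             ≡⟨ cong₂ _+_ (lookup-applyMove-∉ m x l∉m) (lookup-applyMove-∉ m y l∉m) ⟨
    lookup (applyMove m x) l + lookup (applyMove m y) l ≡⟨ lookup-zipWith _+_ l (applyMove m x) (applyMove m y) ⟨
    lookup (applyMove m x ⊕ applyMove m y) l            ∎

applyMove-· : ∀ (m : Move n) d x → applyMove m (d · x) ≡ d · applyMove m x
applyMove-· m@(i , j , _) d x = lookup-extensionality at
  where
  open ≡-Reasoning
  at : ∀ l → lookup (applyMove m (d · x)) l ≡ lookup (d · applyMove m x) l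
  at l with l ∈ₘ? m
  ... | inj₁ l∈m = begin
    lookup (applyMove m (d · x)) l      ≡⟨ lookup-applyMove-∈ m (d · x) l∈m ⟩
    lookup (d · x) i + lookup (d · x) j ≡⟨ cong₂ _+_ (lookup-map i (d *_) x) (lookup-map j (d *_) x) ⟩
    d * lookup x i + d * lookup x j     ≡⟨ *-distribˡ-+ d _ _ ⟨
    d * pairSum m x                     ≡⟨ cong (d *_) (lookup-applyMove-∈ m x l∈m) ⟨
    d * lookup (applyMove m x) l        ≡⟨ lookup-map l (d *_) (applyMove m x) ⟨
    lookup (d · applyMove m x) l        ∎
  ... | inj₂ l∉m = begin
    lookup (applyMove m (d · x)) l      ≡⟨ lookup-applyMove-∉ m (d · x) l∉m ⟩
    lookup (d · x) l                    ≡⟨ lookup-map l (d *_) x ⟩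
    d * lookup x l                      ≡⟨ cong (d *_) (lookup-applyMove-∉ m x l∉m) ⟨
    d * lookup (applyMove m x) l        ≡⟨ lookup-map l (d *_) (applyMove m x) ⟨
    lookup (d · applyMove m x) l        ∎

sum-⊕ : ∀ (x y : Config n) → sum (x ⊕ y) ≡ sum x + sum y
sum-⊕ []       []       = refl
sum-⊕ (x ∷ xs) (y ∷ ys) = trans (cong (x + y +_) (sum-⊕ xs ys)) (interchange x y (sum xs) (sum ys))

sum-· : ∀ d (x : Config n) → sum (d · x) ≡ d * sum x
sum-· d []       = sym (*-zeroʳ d)
sum-· d (x ∷ xs) = trans (cong (d * x +_) (sum-· d xs)) (sym (*-distribˡ-+ d x _))

cost-affine : ∀ (ms : List (Move n)) d x e → cost ms (x ⊕ d · e) ≡ cost ms x + d * cost ms e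
cost-affine []       d x e = trans (sum-⊕ x (d · e)) (cong (sum x +_) (sum-· d e))
cost-affine (m ∷ ms) d x e = begin
  cost ms (applyMove m (x ⊕ d · e))                ≡⟨ cong (cost ms) (applyMove-⊕ m x (d · e)) ⟩
  cost ms (applyMove m x ⊕ applyMove m (d · e))    ≡⟨ cong (λ z → cost ms (applyMove m x ⊕ z)) (applyMove-· m d e) ⟩
  cost ms (applyMove m x ⊕ d · applyMove m e)      ≡⟨ cost-affine ms d (applyMove m x) (applyMove m e) ⟩
  cost ms (applyMove m x) + d * cost ms (applyMove m e) ∎
  where open ≡-Reasoning

cost-balance : ∀ (ms : List (Move n)) d {x y e f : Config n} →
  (∀ l → lookup x l + d * lookup e l ≡ lookup y l + d * lookup f l) →
  cost ms f ≤ cost ms e → cost ms x ≤ cost ms y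
cost-balance ms d {x} {y} {e} {f} balanced f≤e = +-cancelʳ-≤ (d * cost ms e) _ _ (begin
  cost ms x + d * cost ms e  ≡⟨ cost-affine ms d x e ⟨
  cost ms (x ⊕ d · e)        ≡⟨ cong (cost ms) (lookup-extensionality at) ⟩
  cost ms (y ⊕ d · f)        ≡⟨ cost-affine ms d y f ⟩
  cost ms y + d * cost ms f  ≤⟨ +-monoʳ-≤ (cost ms y) (*-monoʳ-≤ d f≤e) ⟩
  cost ms y + d * cost ms e  ∎)
  where
  open ≤-Reasoning
  lookup-⊕· : ∀ (z g : Config n) l → lookup (z ⊕ d · g) l ≡ lookup z l + d * lookup g l
  lookup-⊕· z g l = trans (lookup-zipWith _+_ l z (d · g)) (cong (lookup z l +_) (lookup-map l (d *_) g))
  at : ∀ l → lookup (x ⊕ d · e) l ≡ lookup (y ⊕ d · f) l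
  at l = trans (lookup-⊕· x e l) (trans (balanced l) (sym (lookup-⊕· y f l)))

permute : Permutation′ n → Config n → Config n
permute π x = tabulate (λ l → lookup x (π ⟨$⟩ʳ l))

lookup-permute : ∀ (π : Permutation′ n) x l → lookup (permute π x) l ≡ lookup x (π ⟨$⟩ʳ l)
lookup-permute π x l = lookup∘tabulate (λ l → lookup x (π ⟨$⟩ʳ l)) l

⟨$⟩ʳ-injective : ∀ (π : Permutation′ n) {i j} → π ⟨$⟩ʳ i ≡ π ⟨$⟩ʳ j → i ≡ j
⟨$⟩ʳ-injective π eq = trans (sym (inverseˡ π)) (trans (cong (π ⟨$⟩ˡ_) eq) (inverseˡ π))

relabelMove : Permutation′ n → Move n → Move n
relabelMove π (i , j , i≢j) = π ⟨$⟩ʳ i , π ⟨$⟩ʳ j , i≢j ∘ ⟨$⟩ʳ-injective π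

permute-applyMove : ∀ (π : Permutation′ n) m x →
  permute π (applyMove (relabelMove π m) x) ≡ applyMove m (permute π x)
permute-applyMove π m@(i , j , _) x = lookup-extensionality at
  where
  open ≡-Reasoning
  πm = relabelMove π m
  at : ∀ l → lookup (permute π (applyMove πm x)) l ≡ lookup (applyMove m (permute π x)) l
  at l with l ∈ₘ? m
  ... | inj₁ l∈m = begin
    lookup (permute π (applyMove πm x)) l      ≡⟨ lookup-permute π (applyMove πm x) l ⟩
    lookup (applyMove πm x) (π ⟨$⟩ʳ l)         ≡⟨ lookup-applyMove-∈ πm x (Sum.map (cong (π ⟨$⟩ʳ_)) (cong (π ⟨$⟩ʳ_)) l∈m) ⟩
    lookup x (π ⟨$⟩ʳ i) + lookup x (π ⟨$⟩ʳ j)  ≡⟨ cong₂ _+_ (lookup-permute π x i) (lookup-permute π x j) ⟨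
    pairSum m (permute π x)                    ≡⟨ lookup-applyMove-∈ m (permute π x) l∈m ⟨
    lookup (applyMove m (permute π x)) l       ∎
  ... | inj₂ (l≢i , l≢j) = begin
    lookup (permute π (applyMove πm x)) l      ≡⟨ lookup-permute π (applyMove πm x) l ⟩
    lookup (applyMove πm x) (π ⟨$⟩ʳ l)         ≡⟨ lookup-applyMove-∉ πm x (l≢i ∘ ⟨$⟩ʳ-injective π , l≢j ∘ ⟨$⟩ʳ-injective π) ⟩
    lookup x (π ⟨$⟩ʳ l)                        ≡⟨ lookup-permute π x l ⟨
    lookup (permute π x) l                     ≡⟨ lookup-applyMove-∉ m (permute π x) (l≢i , l≢j) ⟨
    lookup (applyMove m (permute π x)) l       ∎

sum-tabulate : ∀ (f : Fin n → ℕ) → sum (tabulate f) ≡ FinSum.sum f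
sum-tabulate {zero}  f = refl
sum-tabulate {suc n} f = cong (f Fin.zero +_) (sum-tabulate (f ∘ Fin.suc))

sum-permute : ∀ (π : Permutation′ n) x → sum (permute π x) ≡ sum x
sum-permute π x = begin
  sum (permute π x)                  ≡⟨ sum-tabulate (lookup x ∘ (π ⟨$⟩ʳ_)) ⟩
  FinSum.sum (lookup x ∘ (π ⟨$⟩ʳ_))  ≡⟨ FinSum.sum-permute (lookup x) π ⟨
  FinSum.sum (lookup x)              ≡⟨ sum-tabulate (lookup x) ⟨
  sum (tabulate (lookup x))          ≡⟨ cong sum (tabulate∘lookup x) ⟩
  sum x                              ∎
  where open ≡-Reasoning

cost-relabel : ∀ (π : Permutation′ n) ms x → cost (List.map (relabelMove π) ms) x ≡ cost ms (permute π x)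
cost-relabel π []       x = sym (sum-permute π x)
cost-relabel π (m ∷ ms) x = trans (cost-relabel π ms (applyMove (relabelMove π m) x))
                                  (cong (cost ms) (permute-applyMove π m x))

transpose-ˡ : ∀ (i j : Fin n) → transpose i j ⟨$⟩ʳ i ≡ j
transpose-ˡ i j rewrite dec-true (i ≟ i) refl = refl

transpose-ʳ : ∀ (i j : Fin n) → transpose i j ⟨$⟩ʳ j ≡ i
transpose-ʳ i j with j ≟ i
... | yes j≡i = j≡i
... | no _ rewrite dec-true (j ≟ j) refl = refl

transpose-fixes : ∀ {i j k : Fin n} → k ≢ i → k ≢ j → transpose i j ⟨$⟩ʳ k ≡ k
transpose-fixes {i = i} {j} {k} k≢i k≢j rewrite dec-false (k ≟ i) k≢i | dec-false (k ≟ j) k≢j = refl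

SmallestMove : Config n → Move n → Set
SmallestMove s m@(a , b , _) = ∀ l → l ∉ₘ m → lookup s a ≤ lookup s l × lookup s b ≤ lookup s l

smallestMove-flip : ∀ (s : Config n) m → SmallestMove s m → SmallestMove s (flipMove m)
smallestMove-flip _ (a , b , _) small l (l≢b , l≢a) = Product.swap (small l (l≢a , l≢b))

minima⇒smallestMove : ∀ (s : Config n) {a b} (a≢b : a ≢ b) → (∀ l → lookup s a ≤ lookup s l) →
  (∀ l → l ≢ a → lookup s b ≤ lookup s l) → SmallestMove s (a , b , a≢b)
minima⇒smallestMove _ _ a-min b-min l (l≢a , _) = a-min l , b-min l l≢a

pairSum-minimal : ∀ (s : Config n) m → SmallestMove s m → ∀ m' → pairSum m s ≤ pairSum m' s
pairSum-minimal s (a , b , _) small (i , j , i≢j) with i ≟ a | i ≟ b | j ≟ a | j ≟ b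
... | yes refl | _        | yes refl | _        = ⊥-elim (i≢j refl)
... | no _     | yes refl | _        | yes refl = ⊥-elim (i≢j refl)
... | yes refl | _        | _        | yes refl = ≤-refl
... | no _     | yes refl | yes refl | _        = ≤-reflexive (+-comm (lookup s j) (lookup s i))
... | yes refl | _        | no j≢a   | no j≢b   = +-monoʳ-≤ (lookup s i) (proj₂ (small j (j≢a , j≢b)))
... | no _     | yes refl | no j≢a   | no j≢b   =
  ≤-trans (+-monoˡ-≤ (lookup s i) (proj₁ (small j (j≢a , j≢b)))) (≤-reflexive (+-comm (lookup s j) (lookup s i)))
... | no i≢a   | no i≢b   | yes refl | _        =
  ≤-trans (+-monoʳ-≤ (lookup s j) (proj₂ (small i (i≢a , i≢b)))) (≤-reflexive (+-comm (lookup s j) (lookup s i)))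
... | no i≢a   | no i≢b   | no _     | yes refl = +-monoˡ-≤ (lookup s j) (proj₁ (small i (i≢a , i≢b)))
... | no i≢a   | no i≢b   | no j≢a   | no j≢b   = +-mono-≤ (proj₁ (small i (i≢a , i≢b))) (proj₂ (small j (j≢a , j≢b)))

MinimumOn : Config n → (Fin n → Set) → Fin n → Set
MinimumOn x P r = P r × ∀ l → P l → lookup x r ≤ lookup x l

minimumOn : ∀ (x : Config n) {P} → Decidable P → (∀ l → ¬ P l) ⊎ ∃ (MinimumOn x P)
minimumOn []       P? = inj₁ λ ()
minimumOn (x ∷ xs) P? with minimumOn xs (P? ∘ Fin.suc) | P? Fin.zero
... | inj₁ none | no ¬p₀ = inj₁ λ { Fin.zero → ¬p₀ ; (Fin.suc l) → none l }
... | inj₁ none | yes p₀ = inj₂ (Fin.zero , p₀ , λ { Fin.zero _ → ≤-refl ; (Fin.suc l) pl → ⊥-elim (none l pl) })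
... | inj₂ (r , pr , r-min) | no ¬p₀ = inj₂ (Fin.suc r , pr , λ { Fin.zero p₀ → ⊥-elim (¬p₀ p₀) ; (Fin.suc l) → r-min l })
... | inj₂ (r , pr , r-min) | yes p₀ with x ≤? lookup xs r
...   | yes x≤r = inj₂ (Fin.zero , p₀ , λ { Fin.zero _ → ≤-refl ; (Fin.suc l) pl → ≤-trans x≤r (r-min l pl) })
...   | no x≰r  = inj₂ (Fin.suc r , pr , λ { Fin.zero _ → <⇒≤ (≰⇒> x≰r) ; (Fin.suc l) → r-min l })

minimum : ∀ (x : Config n) {P} → Decidable P → ∃ P → ∃ (MinimumOn x P)
minimum x P? (l , pl) with minimumOn x P?
... | inj₁ none = ⊥-elim (none l pl)
... | inj₂ min  = min

smallestMove-exists : ∀ (s : Config (2 + n)) → ∃ (SmallestMove s)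
smallestMove-exists s =
  let a , _ , a-min   = minimum s {λ _ → ⊤} (λ _ → yes tt) (Fin.zero , tt)
      b , b≢a , b-min = minimum s (λ l → ¬? (l ≟ a)) (another a)
  in (a , b , b≢a ∘ sym) , minima⇒smallestMove s (b≢a ∘ sym) (λ l → a-min l tt) b-min
  where
  another : ∀ (a : Fin (2 + _)) → ∃ (_≢ a)
  another Fin.zero    = Fin.suc Fin.zero , λ ()
  another (Fin.suc _) = Fin.zero , λ ()

OptAtMost : Config n → ℕ → ℕ → Set
OptAtMost {n} x k c = Σ (List (Move n)) λ ms → length ms ≡ k × cost ms x ≤ c

Simulates : Config n → Config n → Set
Simulates {n} x y = (ms : List (Move n)) → OptAtMost x (suc (length ms)) (cost ms y)

simulate : ∀ {x y : Config n} {k c} → Simulates x y → OptAtMost y k c → OptAtMost x (suc k) c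
simulate sim (ms , refl , ms≤c) with sim ms
... | ms' , len , ms'≤ = ms' , len , ≤-trans ms'≤ ms≤c

prepend-relabelled : ∀ (m : Move n) (π : Permutation′ n) ms {x y} →
  cost ms (permute π (applyMove m x)) ≤ cost ms y → OptAtMost x (suc (length ms)) (cost ms y)
prepend-relabelled m π ms {x} le =
  m ∷ List.map (relabelMove π) ms , cong suc (length-map _ ms) ,
  subst (_≤ _) (sym (cost-relabel π ms (applyMove m x))) le

by-position₃ : ∀ {P : Fin n → Set} a b c → P a → P b → P c →
  (∀ l → l ≢ a → l ≢ b → l ≢ c → P l) → ∀ l → P l
by-position₃ a b c pa pb pc rest l with l ≟ a | l ≟ b | l ≟ c
... | yes refl | _        | _        = pa
... | no _     | yes refl | _        = pb
... | no _     | no _     | yes refl = pc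
... | no l≢a   | no l≢b   | no l≢c   = rest l l≢a l≢b l≢c

by-position₄ : ∀ {P : Fin n → Set} a b c r → P a → P b → P c → P r →
  (∀ l → l ≢ a → l ≢ b → l ≢ c → l ≢ r → P l) → ∀ l → P l
by-position₄ a b c r pa pb pc pr rest =
  by-position₃ a b c pa pb pc λ l l≢a l≢b l≢c → case-r l l≢a l≢b l≢c (l ≟ r)
  where
  case-r : ∀ l → l ≢ a → l ≢ b → l ≢ c → Dec (l ≡ r) → _
  case-r l _ _ _ (yes refl) = pr
  case-r l l≢a l≢b l≢c (no l≢r) = rest l l≢a l≢b l≢c l≢r

module ChainExchange (s : Config n) {a b c : Fin n} (a≢b : a ≢ b) (a≢c : a ≢ c) (b≢c : b ≢ c) where

  ab bc ac ba : Move n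
  ab = a , b , a≢b
  bc = b , c , b≢c
  ac = a , c , a≢c
  ba = b , a , a≢b ∘ sym

  X Y : Config n
  X = applyMove bc (applyMove ab s)
  Y = applyMove ba (applyMove ac s)

  X-bc : ∀ {l} → l ∈ₘ bc → lookup X l ≡ (lookup s a + lookup s b) + lookup s c
  X-bc l∈bc = trans (lookup-applyMove-∈ bc (applyMove ab s) l∈bc)
                    (cong₂ _+_ (lookup-applyMove-∈ ab s (inj₂ refl)) (lookup-applyMove-∉ ab s (a≢c ∘ sym , b≢c ∘ sym)))

  X-a : lookup X a ≡ lookup s a + lookup s b
  X-a = trans (lookup-applyMove-∉ bc (applyMove ab s) (a≢b , a≢c)) (lookup-applyMove-∈ ab s (inj₁ refl))

  Y-ab : ∀ {l} → l ∈ₘ ba → lookup Y l ≡ lookup s b + (lookup s a + lookup s c)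
  Y-ab l∈ba = trans (lookup-applyMove-∈ ba (applyMove ac s) l∈ba)
                    (cong₂ _+_ (lookup-applyMove-∉ ac s (a≢b ∘ sym , b≢c)) (lookup-applyMove-∈ ac s (inj₁ refl)))

  Y-c : lookup Y c ≡ lookup s a + lookup s c
  Y-c = trans (lookup-applyMove-∉ ba (applyMove ac s) (b≢c ∘ sym , a≢c ∘ sym)) (lookup-applyMove-∈ ac s (inj₂ refl))

  XY-elsewhere : ∀ {l} → l ≢ a → l ≢ b → l ≢ c → lookup X l ≡ lookup Y l
  XY-elsewhere l≢a l≢b l≢c =
    trans (trans (lookup-applyMove-∉ bc (applyMove ab s) (l≢b , l≢c)) (lookup-applyMove-∉ ab s (l≢a , l≢b)))
          (sym (trans (lookup-applyMove-∉ ba (applyMove ac s) (l≢b , l≢a)) (lookup-applyMove-∉ ac s (l≢a , l≢c))))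

  dominated : lookup s b ≤ lookup s c → permute (transpose a c) X ≤ᶜ Y
  dominated sb≤sc = by-position₃ a b c
    (≤-by (trans (permuted (transpose-ˡ a c)) (X-bc (inj₂ refl))) (Y-ab (inj₂ refl)) (≤-reflexive reassociate))
    (≤-by (trans (permuted (transpose-fixes (a≢b ∘ sym) b≢c)) (X-bc (inj₁ refl))) (Y-ab (inj₁ refl)) (≤-reflexive reassociate))
    (≤-by (trans (permuted (transpose-ʳ a c)) X-a) Y-c (+-monoʳ-≤ (lookup s a) sb≤sc))
    λ l l≢a l≢b l≢c → ≤-by (trans (permuted (transpose-fixes l≢a l≢c)) (XY-elsewhere l≢a l≢b l≢c)) refl ≤-refl
    where
    permuted : ∀ {l k} → transpose a c ⟨$⟩ʳ l ≡ k → lookup (permute (transpose a c) X) l ≡ lookup X k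
    permuted {l} eq = trans (lookup-permute (transpose a c) X l) (cong (lookup X) eq)
    reassociate : (lookup s a + lookup s b) + lookup s c ≡ lookup s b + (lookup s a + lookup s c)
    reassociate = trans (cong (_+ lookup s c) (+-comm (lookup s a) _)) (+-assoc (lookup s b) _ _)

  simulates : lookup s b ≤ lookup s c → Simulates (applyMove ab s) Y
  simulates sb≤sc ms =
    prepend-relabelled bc (transpose a c) ms (cost-mono ms {permute (transpose a c) X} {Y} (dominated sb≤sc))

indicator : Move n → Config n
indicator {n} (i , j , _) = (replicate n 0 [ i ]≔ 1) [ j ]≔ 1

lookup-indicator-∈ : ∀ (m : Move n) {l} → l ∈ₘ m → lookup (indicator m) l ≡ 1
lookup-indicator-∈ {n} (i , j , i≢j) (inj₁ refl) =
  trans (lookup∘update′ i≢j (replicate n 0 [ i ]≔ 1) 1) (lookup∘update i (replicate n 0) 1)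
lookup-indicator-∈ {n} (i , j , _) (inj₂ refl) = lookup∘update j (replicate n 0 [ i ]≔ 1) 1

lookup-indicator-∉ : ∀ (m : Move n) {l} → l ∉ₘ m → lookup (indicator m) l ≡ 0
lookup-indicator-∉ {n} (i , j , _) {l} (l≢i , l≢j) =
  trans (lookup∘update′ l≢j (replicate n 0 [ i ]≔ 1) 1)
        (trans (lookup∘update′ l≢i (replicate n 0) 1) (lookup-replicate l 0))

balanced-by : ∀ d {p p′ e e′ q q′ f f′} → p ≡ p′ → e ≡ e′ → q ≡ q′ → f ≡ f′ →
  p′ + d * e′ ≡ q′ + d * f′ → p + d * e ≡ q + d * f
balanced-by _ refl refl refl refl eq = eq

rebalance₁ : ∀ {y z} d → y + d ≡ z → ∀ x → (x + y) + d * 1 ≡ (x + z) + d * 0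
rebalance₁ {y} d refl x = identity x y d
  where
  identity : ∀ x y d → (x + y) + d * 1 ≡ (x + (y + d)) + d * 0
  identity = solve-∀

rebalance₂ : ∀ {y z} d → y + d ≡ z → ∀ x → (z + x) + d * 0 ≡ (y + x) + d * 1
rebalance₂ {y} d refl x = identity x y d
  where
  identity : ∀ x y d → ((y + d) + x) + d * 0 ≡ (y + x) + d * 1
  identity = solve-∀

rebalance₃ : ∀ {y z} d → y + d ≡ z → ∀ x → (x + z) + d * 0 ≡ (y + x) + d * 1
rebalance₃ {y} d refl x = identity x y d
  where
  identity : ∀ x y d → (x + (y + d)) + d * 0 ≡ (y + x) + d * 1
  identity = solve-∀

module CrossExchange (s : Config n) {a b c r : Fin n} (a≢b : a ≢ b) (a≢c : a ≢ c) (a≢r : a ≢ r)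
                     (b≢c : b ≢ c) (b≢r : b ≢ r) (c≢r : c ≢ r) where

  ab cr ac br : Move n
  ab = a , b , a≢b
  cr = c , r , c≢r
  ac = a , c , a≢c
  br = b , r , b≢r

  X Y : Config n
  X = applyMove cr (applyMove ab s)
  Y = applyMove br (applyMove ac s)

  X-ab : ∀ {l} → l ∈ₘ ab → l ∉ₘ cr → lookup X l ≡ lookup s a + lookup s b
  X-ab l∈ab l∉cr = trans (lookup-applyMove-∉ cr (applyMove ab s) l∉cr) (lookup-applyMove-∈ ab s l∈ab)

  X-cr : ∀ {l} → l ∈ₘ cr → lookup X l ≡ lookup s c + lookup s r
  X-cr l∈cr = trans (lookup-applyMove-∈ cr (applyMove ab s) l∈cr)
    (cong₂ _+_ (lookup-applyMove-∉ ab s (a≢c ∘ sym , b≢c ∘ sym)) (lookup-applyMove-∉ ab s (a≢r ∘ sym , b≢r ∘ sym)))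

  Y-ac : ∀ {l} → l ∈ₘ ac → l ∉ₘ br → lookup Y l ≡ lookup s a + lookup s c
  Y-ac l∈ac l∉br = trans (lookup-applyMove-∉ br (applyMove ac s) l∉br) (lookup-applyMove-∈ ac s l∈ac)

  Y-br : ∀ {l} → l ∈ₘ br → lookup Y l ≡ lookup s b + lookup s r
  Y-br l∈br = trans (lookup-applyMove-∈ br (applyMove ac s) l∈br)
    (cong₂ _+_ (lookup-applyMove-∉ ac s (a≢b ∘ sym , b≢c)) (lookup-applyMove-∉ ac s (a≢r ∘ sym , c≢r ∘ sym)))

  X-elsewhere : ∀ {l} → l ≢ a → l ≢ b → l ≢ c → l ≢ r → lookup X l ≡ lookup s l
  X-elsewhere l≢a l≢b l≢c l≢r =
    trans (lookup-applyMove-∉ cr (applyMove ab s) (l≢c , l≢r)) (lookup-applyMove-∉ ab s (l≢a , l≢b))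

  Y-elsewhere : ∀ {l} → l ≢ a → l ≢ b → l ≢ c → l ≢ r → lookup Y l ≡ lookup s l
  Y-elsewhere l≢a l≢b l≢c l≢r =
    trans (lookup-applyMove-∉ br (applyMove ac s) (l≢b , l≢r)) (lookup-applyMove-∉ ac s (l≢a , l≢c))

  permuted : ∀ π {l k} → π ⟨$⟩ʳ l ≡ k → lookup (permute π X) l ≡ lookup X k
  permuted π {l} eq = trans (lookup-permute π X l) (cong (lookup X) eq)

  balanceᵇᶜ : ∀ {d} → lookup s b + d ≡ lookup s c →
    ∀ l → lookup (permute (transpose b c) X) l + d * lookup (indicator ac) l ≡ lookup Y l + d * lookup (indicator br) l
  balanceᵇᶜ {d} e = by-position₄ a b c r
    (balanced-by d (trans (permuted (transpose b c) (transpose-fixes a≢b a≢c)) (X-ab (inj₁ refl) (a≢c , a≢r)))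
      (lookup-indicator-∈ ac (inj₁ refl)) (Y-ac (inj₁ refl) (a≢b , a≢r)) (lookup-indicator-∉ br (a≢b , a≢r))
      (rebalance₁ d e (lookup s a)))
    (balanced-by d (trans (permuted (transpose b c) (transpose-ˡ b c)) (X-cr (inj₁ refl)))
      (lookup-indicator-∉ ac (a≢b ∘ sym , b≢c)) (Y-br (inj₁ refl)) (lookup-indicator-∈ br (inj₁ refl))
      (rebalance₂ d e (lookup s r)))
    (balanced-by d (trans (permuted (transpose b c) (transpose-ʳ b c)) (X-ab (inj₂ refl) (b≢c , b≢r)))
      (lookup-indicator-∈ ac (inj₂ refl)) (Y-ac (inj₂ refl) (b≢c ∘ sym , c≢r)) (lookup-indicator-∉ br (b≢c ∘ sym , c≢r))
      (rebalance₁ d e (lookup s a)))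
    (balanced-by d (trans (permuted (transpose b c) (transpose-fixes (b≢r ∘ sym) (c≢r ∘ sym))) (X-cr (inj₂ refl)))
      (lookup-indicator-∉ ac (a≢r ∘ sym , c≢r ∘ sym)) (Y-br (inj₂ refl)) (lookup-indicator-∈ br (inj₂ refl))
      (rebalance₂ d e (lookup s r)))
    λ l l≢a l≢b l≢c l≢r →
      balanced-by d (trans (permuted (transpose b c) (transpose-fixes l≢b l≢c)) (X-elsewhere l≢a l≢b l≢c l≢r))
        (lookup-indicator-∉ ac (l≢a , l≢c)) (Y-elsewhere l≢a l≢b l≢c l≢r) (lookup-indicator-∉ br (l≢b , l≢r)) refl

  balanceᵃʳ : ∀ {d} → lookup s a + d ≡ lookup s r →
    ∀ l → lookup (permute (transpose a r) X) l + d * lookup (indicator br) l ≡ lookup Y l + d * lookup (indicator ac) l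
  balanceᵃʳ {d} e = by-position₄ a b c r
    (balanced-by d (trans (permuted (transpose a r) (transpose-ˡ a r)) (X-cr (inj₂ refl)))
      (lookup-indicator-∉ br (a≢b , a≢r)) (Y-ac (inj₁ refl) (a≢b , a≢r)) (lookup-indicator-∈ ac (inj₁ refl))
      (rebalance₃ d e (lookup s c)))
    (balanced-by d (trans (permuted (transpose a r) (transpose-fixes (a≢b ∘ sym) b≢r)) (X-ab (inj₂ refl) (b≢c , b≢r)))
      (lookup-indicator-∈ br (inj₁ refl)) (Y-br (inj₁ refl)) (lookup-indicator-∉ ac (a≢b ∘ sym , b≢c))
      (sym (rebalance₃ d e (lookup s b))))
    (balanced-by d (trans (permuted (transpose a r) (transpose-fixes (a≢c ∘ sym) c≢r)) (X-cr (inj₁ refl)))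
      (lookup-indicator-∉ br (b≢c ∘ sym , c≢r)) (Y-ac (inj₂ refl) (b≢c ∘ sym , c≢r)) (lookup-indicator-∈ ac (inj₂ refl))
      (rebalance₃ d e (lookup s c)))
    (balanced-by d (trans (permuted (transpose a r) (transpose-ʳ a r)) (X-ab (inj₁ refl) (a≢c , a≢r)))
      (lookup-indicator-∈ br (inj₂ refl)) (Y-br (inj₂ refl)) (lookup-indicator-∉ ac (a≢r ∘ sym , c≢r ∘ sym))
      (sym (rebalance₃ d e (lookup s b))))
    λ l l≢a l≢b l≢c l≢r →
      balanced-by d (trans (permuted (transpose a r) (transpose-fixes l≢a l≢r)) (X-elsewhere l≢a l≢b l≢c l≢r))
        (lookup-indicator-∉ br (l≢b , l≢r)) (Y-elsewhere l≢a l≢b l≢c l≢r) (lookup-indicator-∉ ac (l≢a , l≢c)) refl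

  -- X with b, c swapped is Y + d (1_br − 1_ac), and X with a, r swapped is Y + d′ (1_ac − 1_br),
  -- where d = s_c − s_b and d′ = s_r − s_a; by linearity one of the two costs no more than Y.
  simulates : lookup s b ≤ lookup s c → lookup s a ≤ lookup s r → Simulates (applyMove ab s) Y
  simulates sb≤sc sa≤sr ms with cost ms (indicator br) ≤? cost ms (indicator ac)
  ... | yes br≤ac =
    let d , e = m≤n⇒∃[o]m+o≡n sb≤sc in
    prepend-relabelled cr (transpose b c) ms
      (cost-balance ms d {permute (transpose b c) X} {Y} {indicator ac} {indicator br} (balanceᵇᶜ e) br≤ac)
  ... | no br≰ac =
    let d , e = m≤n⇒∃[o]m+o≡n sa≤sr in
    prepend-relabelled cr (transpose a r) ms
      (cost-balance ms d {permute (transpose a r) X} {Y} {indicator br} {indicator ac} (balanceᵃʳ e) (<⇒≤ (≰⇒> br≰ac)))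

smallestMove-untouched : ∀ (s : Config n) m m' → SmallestMove s m → Disjoint m' m → SmallestMove (applyMove m' s) m
smallestMove-untouched s (a , b , _) m' small (a∉m' , b∉m') l l∉m =
  ≤-by (lookup-applyMove-∉ m' s a∉m') refl (≤-trans (proj₁ (small l l∉m)) (applyMove-increasing m' s l)) ,
  ≤-by (lookup-applyMove-∉ m' s b∉m') refl (≤-trans (proj₂ (small l l∉m)) (applyMove-increasing m' s l))

Exchange : ℕ → Set
Exchange k = ∀ {n} (s : Config n) m → SmallestMove s m →
  ∀ m' (ms : List (Move n)) → length ms ≡ k → OptAtMost (applyMove m s) k (cost ms (applyMove m' s))

exchange-disjoint : ∀ {k} → Exchange k → (s : Config n) (m m' : Move n) → SmallestMove s m → Disjoint m m' →
  ∀ m₂ ms → length ms ≡ k → OptAtMost (applyMove m s) (suc k) (cost (m₂ ∷ ms) (applyMove m' s))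
exchange-disjoint IH s m m' small disj m₂ ms len =
  simulate delay (IH (applyMove m' s) m (smallestMove-untouched s m m' small (disjoint-sym m m' disj)) m₂ ms len)
  where
  delay : Simulates (applyMove m s) (applyMove m (applyMove m' s))
  delay ms' = m' ∷ ms' , refl ,
    ≤-reflexive (cong (cost ms') (applyMove-comm m' m s (disjoint-sym m m' disj)))

exchange-adjacent : ∀ {k} → Exchange k → (s : Config n) {a b c : Fin n} (a≢b : a ≢ b) (a≢c : a ≢ c) →
  c ∉ₘ (a , b , a≢b) → SmallestMove s (a , b , a≢b) → ∀ m₂ ms → length ms ≡ k →
  OptAtMost (applyMove (a , b , a≢b) s) (suc k) (cost (m₂ ∷ ms) (applyMove (a , c , a≢c) s))
exchange-adjacent {k = k} IH s {a} {b} {c} a≢b a≢c (c≢a , c≢b) small m₂ ms len =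
  partner (minimum t (λ l → ¬? (l ≟ b)) (a , a≢b))
  where
  ac : Move _
  ac = a , c , a≢c
  t : Config _
  t = applyMove ac s
  sb≤sc : lookup s b ≤ lookup s c
  sb≤sc = proj₂ (small c (c≢a , c≢b))
  t-b : lookup t b ≡ lookup s b
  t-b = lookup-applyMove-∉ ac s (a≢b ∘ sym , c≢b ∘ sym)
  b-min : ∀ l → lookup t b ≤ lookup t l
  b-min l with l ∈ₘ? ac | l ≟ b
  ... | inj₁ l∈ac  | _        = ≤-by t-b (lookup-applyMove-∈ ac s l∈ac) (≤-trans sb≤sc (m≤n+m _ _))
  ... | inj₂ _     | yes refl = ≤-refl
  ... | inj₂ l∉ac  | no l≢b   = ≤-by t-b (lookup-applyMove-∉ ac s l∉ac) (proj₂ (small l (proj₁ l∉ac , l≢b)))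
  partner : ∃ (MinimumOn t (_≢ b)) → OptAtMost (applyMove (a , b , a≢b) s) (suc k) (cost (m₂ ∷ ms) t)
  partner (r , r≢b , r-min) with r ∈ₘ? ac
  ... | inj₁ r∈ac = simulate (ChainExchange.simulates s a≢b a≢c (c≢b ∘ sym) sb≤sc)
                      (IH t (b , a , a≢b ∘ sym) (minima⇒smallestMove t (a≢b ∘ sym) b-min a-min) m₂ ms len)
    where
    a-min : ∀ l → l ≢ b → lookup t a ≤ lookup t l
    a-min l l≢b = ≤-by (trans (lookup-applyMove-∈ ac s (inj₁ refl)) (sym (lookup-applyMove-∈ ac s r∈ac)))
                       refl (r-min l l≢b)
  ... | inj₂ (r≢a , r≢c) =
    simulate (CrossExchange.simulates s a≢b a≢c (r≢a ∘ sym) (c≢b ∘ sym) (r≢b ∘ sym) (r≢c ∘ sym) sb≤sc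
                             (proj₁ (small r (r≢a , r≢b))))
             (IH t (b , r , r≢b ∘ sym) (minima⇒smallestMove t (r≢b ∘ sym) b-min r-min) m₂ ms len)

exchange : ∀ k → Exchange k
exchange zero s m small m' [] refl = [] , refl , (begin
  sum (applyMove m s)    ≡⟨ sum-applyMove m s ⟩
  sum s + pairSum m s    ≤⟨ +-monoʳ-≤ (sum s) (pairSum-minimal s m small m') ⟩
  sum s + pairSum m' s   ≡⟨ sum-applyMove m' s ⟨
  sum (applyMove m' s)   ∎)
  where open ≤-Reasoning
exchange (suc k) s m@(a , b , a≢b) small m'@(i , j , i≢j) (m₂ ∷ ms) len
  with i ≟ a | i ≟ b | j ≟ a | j ≟ b
... | yes refl | _        | yes refl | _        = ⊥-elim (i≢j refl)
... | no _     | yes refl | _        | yes refl = ⊥-elim (i≢j refl)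
... | yes refl | _        | _        | yes refl = m₂ ∷ ms , len , ≤-refl
... | no _     | yes refl | yes refl | _        =
  m₂ ∷ ms , len , ≤-reflexive (cong (cost (m₂ ∷ ms)) (sym (applyMove-flip m s)))
... | yes refl | _        | no j≢a   | no j≢b   =
  exchange-adjacent (exchange k) s a≢b i≢j (j≢a , j≢b) small m₂ ms (suc-injective len)
... | no _     | yes refl | no j≢a   | no j≢b   =
  subst (λ x → OptAtMost x (suc k) _) (applyMove-flip m s)
    (exchange-adjacent (exchange k) s (a≢b ∘ sym) i≢j (j≢b , j≢a) (smallestMove-flip s m small) m₂ ms (suc-injective len))
... | no i≢a   | no i≢b   | yes refl | _        =
  subst (OptAtMost (applyMove m s) (suc k)) (cong (cost (m₂ ∷ ms)) (applyMove-flip m' s))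
    (exchange-adjacent (exchange k) s a≢b (i≢j ∘ sym) (i≢a , i≢b) small m₂ ms (suc-injective len))
... | no i≢a   | no i≢b   | no _     | yes refl =
  subst₂ (λ x c → OptAtMost x (suc k) c) (applyMove-flip m s) (cong (cost (m₂ ∷ ms)) (applyMove-flip m' s))
    (exchange-adjacent (exchange k) s (a≢b ∘ sym) (i≢j ∘ sym) (i≢b , i≢a) (smallestMove-flip s m small) m₂ ms (suc-injective len))
... | no i≢a   | no i≢b   | no j≢a   | no j≢b   =
  exchange-disjoint (exchange k) s m m' small ((i≢a , i≢b) , (j≢a , j≢b)) m₂ ms (suc-injective len)

optimal-cons : ∀ {k} (s : Config n) m ms → SmallestMove s m →
  OptimalStrategy (applyMove m s) k ms → OptimalStrategy s (suc k) (m ∷ ms)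
optimal-cons {k = k} s m ms small (len , optimal) = cong suc len , λ where
  []          ()
  (m' ∷ ms') len' →
    let ms″ , len″ , ms″≤ms' = exchange k s m small m' ms' (suc-injective len')
    in ≤-trans (optimal ms″ len″) ms″≤ms'

optimal-exists : ∀ k (s : Config (2 + n)) → ∃ (OptimalStrategy s k)
optimal-exists zero s = [] , refl , λ where
  []      _  → ≤-refl
  (_ ∷ _) ()
optimal-exists (suc k) s =
  let m , small = smallestMove-exists s
      ms , optimal = optimal-exists k (applyMove m s)
  in m ∷ ms , optimal-cons s m ms small optimal

sorted⇒smallestMove : ∀ (s : Config (2 + n)) → Sorted s → SmallestMove s (firstTwo n)
sorted⇒smallestMove s sorted Fin.zero                    (0≢0 , _) = ⊥-elim (0≢0 refl)
sorted⇒smallestMove s sorted (Fin.suc Fin.zero)          (_ , 1≢1) = ⊥-elim (1≢1 refl)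
sorted⇒smallestMove s sorted l@(Fin.suc (Fin.suc _)) _ = sorted Fin.zero l z≤n , sorted (Fin.suc Fin.zero) l (s≤s z≤n)

lemma8 : (n k : ℕ) → 1 ≤ k → (s : Vec ℕ (2 + n)) → Positive s → Sorted s →
    Σ (List (Move (2 + n))) λ ms → OptimalStrategy s k (firstTwo n ∷ ms)
lemma8 n (suc k) _ s _ sorted =
  let ms , optimal = optimal-exists k (applyMove (firstTwo n) s)
  in ms , optimal-cons s (firstTwo n) ms (sorted⇒smallestMove s sorted) optimal
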